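{- Let $d \geq 1$, $j \in [d+1]$ and $0 \leq i \leq d$. There is a bijection between the set of pairs $(S,\sigma)$, where $S$ is a $(j-1)$-element subset of $[d]$ and $\sigma \in S_{d+1}$ satisfies $\mathrm{des}(\sigma) = i$ and $\sigma(1) = j$, and the set of signed permutations $\tau \in B_d$ with $\mathrm{des}_B(\tau) = i$ and $N(\tau) = j-1$.
   Context: $[n]=\{1,\dots,n\}$. For $\sigma \in S_{m}$, $\mathrm{des}(\sigma) = \#\{ k \in [m-1] : \sigma(k) > \sigma(k+1)\}$. $B_d$ is the group of bijections $\tau$ of $\{\pm 1, \ldots, \pm d\}$ with $\tau(-k) = -\tau(k)$ for all $k$ (signed permutations). Set $\tau(0) := 0$; an index $k \in \{0,\dots,d-1\}$ is a descent of $\tau$ if $\tau(k) > \tau(k+1)$ (so $0$ is a descent iff $\tau(1)<0$), and $\mathrm{des}_B(\tau)$ is the number of descents. $N(\tau)$ is the number of $k \in [d]$ with $\tau(k) < 0$. -}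

module Defs where

open import Data.Bool using (Bool; true; false; if_then_else_)
open import Data.Nat using (ℕ; zero; suc; _+_; _∸_; _<?_; _≤_)
open import Data.Fin using (Fin; toℕ; fromℕ<)
import Data.Fin
open import Data.Fin.Permutation using (Permutation′; _⟨$⟩ʳ_)
open import Data.Fin.Subset using (Subset; ∣_∣)
open import Data.Integer as ℤ using (ℤ; +_; -_)
open import Data.Product using (Σ; _×_; _,_; proj₁; proj₂)
open import Function.Bundles using (_↔_; Inverse)
open import Relation.Nullary.Decidable using (yes; no; isYes)
open import Relation.Binary.Bundles using (Setoid)
open import Relation.Binary.PropositionalEquality using (_≡_; refl; sym; trans)

count : ℕ → (ℕ → Bool) → ℕ
count zero    p = 0
count (suc n) p = count n p + (if p n then 1 else 0)

-- Ordinary permutations: σ ∈ S_n is a library permutation of Fin n.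
-- Fin n = {0,…,n-1} encodes [n] = {1,…,n} via k ↦ k+1.

-- σ as a function on ℕ, 0-based: σ̂ k = σ(k+1) - 1 for k < n.
apply : ∀ {n} → Permutation′ n → ℕ → ℕ
apply {n} σ k with k <? n
... | yes k<n = toℕ (σ ⟨$⟩ʳ fromℕ< k<n)
... | no  _   = 0

-- des σ = #{k ∈ [n-1] : σ(k) > σ(k+1)}; 0-based index k corresponds to k+1.
des : ∀ {n} → Permutation′ n → ℕ
des {n} σ = count (n ∸ 1) (λ k → isYes (Data.Nat._<?_ (apply σ (suc k)) (apply σ k)))

-- Signed permutations.  ±[d] = {±1,…,±d} is encoded as Sign × Fin d,
-- (pos , k) ↦ k+1 and (neg , k) ↦ -(k+1).

data Sign : Set where
  pos neg : Sign

PM : ℕ → Set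
PM d = Sign × Fin d

negate : ∀ {d} → PM d → PM d
negate (pos , k) = (neg , k)
negate (neg , k) = (pos , k)

value : ∀ {d} → PM d → ℤ
value (pos , k) = + suc (toℕ k)
value (neg , k) = - (+ suc (toℕ k))

SignedPerm : ℕ → Set
SignedPerm d = Σ (PM d ↔ PM d) (λ τ → ∀ x → Inverse.to τ (negate x) ≡ negate (Inverse.to τ x))

-- τ(k) as an integer for k ∈ ℕ, with τ(0) = 0 (and junk 0 beyond d)
applyB : ∀ {d} → SignedPerm d → ℕ → ℤ
applyB τ zero = + 0
applyB {d} τ (suc k) with k <? d
... | yes k<d = value (Inverse.to (proj₁ τ) (pos , fromℕ< k<d))
... | no  _   = + 0

desB : ∀ {d} → SignedPerm d → ℕ
desB {d} τ = count d (λ k → isYes (applyB τ (suc k) ℤ.<? applyB τ k))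

negs : ∀ {d} → SignedPerm d → ℕ
negs {d} τ = count d (λ k → isYes (applyB τ (suc k) ℤ.<? + 0))

PairSetoid : ℕ → ℕ → ℕ → Setoid _ _
PairSetoid d i j = record
  { Carrier = Σ (Subset d × Permutation′ (suc d))
                (λ p → (∣ proj₁ p ∣ ≡ j ∸ 1) × (des (proj₂ p) ≡ i)
                        × (suc (toℕ (proj₂ p ⟨$⟩ʳ Data.Fin.zero)) ≡ j))
  ; _≈_ = λ a b → (proj₁ (proj₁ a) ≡ proj₁ (proj₁ b))
                  × (∀ x → proj₂ (proj₁ a) ⟨$⟩ʳ x ≡ proj₂ (proj₁ b) ⟨$⟩ʳ x)
  ; isEquivalence = record
    { refl  = refl , λ _ → refl
    ; sym   = λ (e , f) → sym e , λ x → sym (f x)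
    ; trans = λ (e , f) (e′ , f′) → trans e e′ , λ x → trans (f x) (f′ x)
    }
  }

SignedSetoid : ℕ → ℕ → ℕ → Setoid _ _
SignedSetoid d i j = record
  { Carrier = Σ (SignedPerm d) (λ τ → (desB τ ≡ i) × (negs τ ≡ j ∸ 1))
  ; _≈_ = λ a b → ∀ x → Inverse.to (proj₁ (proj₁ a)) x ≡ Inverse.to (proj₁ (proj₁ b)) x
  ; isEquivalence = record
    { refl  = λ _ → refl
    ; sym   = λ f x → sym (f x)
    ; trans = λ f g x → trans (f x) (g x)
    }
  }

module Submission where

-- Given S ⊆ [d], list the d+1 integers 0, −k (k ∈ S) and k (k ∈ [d] ∖ S) increasingly as
-- v₁ < ⋯ < v_{d+1}; then 0 = v_{|S|+1}.  For σ ∈ S_{d+1} with σ(1) = j = |S| + 1 put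
-- τ(k) = v_{σ(k+1)} for 0 ≤ k ≤ d.  Then τ(0) = 0 and the |τ(k)| for k ∈ [d] run through [d],
-- so τ is a signed permutation whose negated values form S.  The word τ(0) τ(1) ⋯ τ(d) is
-- order-isomorphic to σ(1) ⋯ σ(d+1), hence des_B τ = des σ, and N τ = |S| = j − 1.
-- Conversely τ determines S as the set of its negated values and σ as the ranking of
-- τ(0), …, τ(d).

open import Defs
open import Data.Bool using (Bool; true; false; if_then_else_)
open import Data.Nat as ℕ using (ℕ; zero; suc; _+_; _≤_; z≤n; s≤s)
import Data.Nat.Properties as ℕP
open import Data.Fin as F using (Fin; toℕ; fromℕ; fromℕ<; inject₁; punchOut)
open import Data.Fin.Properties
  using (any?; _≟_; suc-injective; toℕ-injective; toℕ<n; toℕ-fromℕ; toℕ-fromℕ<; fromℕ<-toℕ;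
         toℕ-inject₁; punchOut-injective; injective⇒≤)
open import Data.Fin.Permutation as Perm
  using (Permutation′; _⟨$⟩ʳ_; _⟨$⟩ˡ_; permutation; inverseˡ; inverseʳ;
         lift₀; remove; flip; _∘ₚ_; lift₀-remove; lift₀-cong)
open import Data.Fin.Subset using (Subset; ∣_∣)
open import Data.Vec using ([]; _∷_; lookup; tabulate)
open import Data.Vec.Properties using (lookup∘tabulate; tabulate∘lookup; tabulate-cong)
open import Data.Integer as ℤ using (ℤ; +_)
import Data.Integer.Properties as ℤP
open import Data.Product using (∃; _,_; proj₁; proj₂)
open import Function.Base using (_∘_)
open import Function.Bundles using (_⇔_; mk⇔; Inverse; Bijection; mk↔ₛ′)
open import Function.Definitions
  using (Injective; Congruent; StrictlyInverseˡ; StrictlyInverseʳ)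
open import Function.Properties.Inverse using (Inverse⇒Bijection)
open import Level using (Level)
open import Relation.Nullary using (Dec; yes; no; ¬_; contradiction)
open import Relation.Nullary.Decidable using (isYes; isYes≗does; does-⇔)
open import Relation.Binary.Bundles using (Setoid; StrictTotalOrder)
open import Relation.Binary.Definitions using (tri<; tri≈; tri>)
open import Relation.Binary.PropositionalEquality
  using (_≡_; _≢_; refl; sym; trans; cong; cong₂; subst₂; module ≡-Reasoning)
open import Algebra.Properties.CommutativeMonoid.Sum ℕP.+-0-commutativeMonoid
  using (sum; sum-cong-≗; sum-permute; sum-init-last)

private
  variable
    p q : Level
    d n : ℕ

indicator : Bool → ℕ
indicator b = if b then 1 else 0

indicator≤1 : ∀ b → indicator b ≤ 1
indicator≤1 true  = s≤s z≤n
indicator≤1 false = z≤n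

isYes-⇔ : {P : Set p} {Q : Set q} → P ⇔ Q → (p? : Dec P) (q? : Dec Q) → isYes p? ≡ isYes q?
isYes-⇔ P⇔Q p? q? = trans (isYes≗does p?) (trans (does-⇔ P⇔Q p? q?) (sym (isYes≗does q?)))

indicator-no : {P : Set p} (p? : Dec P) → ¬ P → indicator (isYes p?) ≡ 0
indicator-no (yes x) ¬x = contradiction x ¬x
indicator-no (no _)  _  = refl

indicator-yes : {P : Set p} (p? : Dec P) → P → indicator (isYes p?) ≡ 1
indicator-yes (yes _) _ = refl
indicator-yes (no ¬x) x = contradiction x ¬x

indicator-mono : {P : Set p} {Q : Set q} (p? : Dec P) (q? : Dec Q) →
                 (P → Q) → indicator (isYes p?) ≤ indicator (isYes q?)
indicator-mono (yes x) q? P→Q = ℕP.≤-reflexive (sym (indicator-yes q? (P→Q x)))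
indicator-mono (no _)  q? _   = z≤n

sum-mono-≤ : {f g : Fin n → ℕ} → (∀ x → f x ≤ g x) → sum f ≤ sum g
sum-mono-≤ {zero}  f≤g = z≤n
sum-mono-≤ {suc n} f≤g = ℕP.+-mono-≤ (f≤g F.zero) (sum-mono-≤ (f≤g ∘ F.suc))

sum-mono-< : {f g : Fin n → ℕ} → (∀ x → f x ≤ g x) → ∀ y → f y ℕ.< g y → sum f ℕ.< sum g
sum-mono-< f≤g F.zero    fy<gy = ℕP.+-mono-<-≤ fy<gy (sum-mono-≤ (f≤g ∘ F.suc))
sum-mono-< f≤g (F.suc y) fy<gy = ℕP.+-mono-≤-< (f≤g F.zero) (sum-mono-< (f≤g ∘ F.suc) y fy<gy)

sum-ones : sum {n} (λ _ → 1) ≡ n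
sum-ones {zero}  = refl
sum-ones {suc n} = cong suc sum-ones

count≡sum : ∀ n (P : ℕ → Bool) → count n P ≡ sum (λ (k : Fin n) → indicator (P (toℕ k)))
count≡sum zero    P = refl
count≡sum (suc n) P = begin
  count n P + indicator (P n)
    ≡⟨ cong₂ _+_ (count≡sum n P) (cong (indicator ∘ P) (sym (toℕ-fromℕ n))) ⟩
  sum (λ (k : Fin n) → indicator (P (toℕ k))) + g (fromℕ n)
    ≡⟨ cong (_+ g (fromℕ n)) (sum-cong-≗ {n} (cong (indicator ∘ P) ∘ sym ∘ toℕ-inject₁)) ⟩
  sum (g ∘ inject₁) + g (fromℕ n)
    ≡⟨ sum-init-last g ⟨
  sum g ∎
  where
  open ≡-Reasoning
  g : Fin (suc n) → ℕ
  g k = indicator (P (toℕ k))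

count-cong : ∀ n {P Q : ℕ → Bool} → (∀ (k : Fin n) → P (toℕ k) ≡ Q (toℕ k)) →
             count n P ≡ count n Q
count-cong n {P} {Q} P≗Q = begin
  count n P                                    ≡⟨ count≡sum n P ⟩
  sum (λ (k : Fin n) → indicator (P (toℕ k)))  ≡⟨ sum-cong-≗ (cong indicator ∘ P≗Q) ⟩
  sum (λ (k : Fin n) → indicator (Q (toℕ k)))  ≡⟨ count≡sum n Q ⟨
  count n Q                                    ∎
  where open ≡-Reasoning

∣p∣≡sum-lookup : (S : Subset n) → ∣ S ∣ ≡ sum (indicator ∘ lookup S)
∣p∣≡sum-lookup []          = refl
∣p∣≡sum-lookup (true ∷ S)  = cong suc (∣p∣≡sum-lookup S)
∣p∣≡sum-lookup (false ∷ S) = ∣p∣≡sum-lookup S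

injective⇒surjective : {f : Fin n → Fin n} → Injective _≡_ _≡_ f → ∀ y → ∃ λ x → f x ≡ y
injective⇒surjective {suc n} {f} f-injective y with any? (λ x → f x ≟ y)
... | yes hit  = hit
... | no  miss = contradiction (injective⇒≤ avoid-injective) ℕP.1+n≰n
  where
  y≢f : ∀ x → y ≢ f x
  y≢f x y≡fx = miss (x , sym y≡fx)

  avoid : Fin (suc n) → Fin n
  avoid x = punchOut (y≢f x)

  avoid-injective : Injective _≡_ _≡_ avoid
  avoid-injective {x} {x′} eq = f-injective (punchOut-injective (y≢f x) (y≢f x′) eq)

injective⇒permutation : (f : Fin n → Fin n) → Injective _≡_ _≡_ f → Permutation′ n
injective⇒permutation {n} f f-injective =
  permutation f f⁻¹ f∘f⁻¹ (λ x → f-injective (f∘f⁻¹ (f x)))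
  where
  f⁻¹ : Fin n → Fin n
  f⁻¹ y = proj₁ (injective⇒surjective f-injective y)

  f∘f⁻¹ : ∀ y → f (f⁻¹ y) ≡ y
  f∘f⁻¹ y = proj₂ (injective⇒surjective f-injective y)

module Ranking {a ℓ₁ ℓ₂} (O : StrictTotalOrder a ℓ₁ ℓ₂) {n : ℕ}
               (v : Fin n → StrictTotalOrder.Carrier O)
               (v-injective : ∀ {x y} → StrictTotalOrder._≈_ O (v x) (v y) → x ≡ y) where

  open StrictTotalOrder O using (_<_; _<?_; compare; irrefl) renaming (trans to <-trans)

  <-irrefl : ∀ {z} → ¬ (z < z)
  <-irrefl = irrefl (StrictTotalOrder.Eq.refl O)

  rankℕ : Fin n → ℕ
  rankℕ x = sum (λ y → indicator (isYes (v y <? v x)))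

  rankℕ-mono : ∀ {x y} → v x < v y → rankℕ x ℕ.< rankℕ y
  rankℕ-mono {x} {y} vx<vy = sum-mono-<
    (λ z → indicator-mono (v z <? v x) (v z <? v y) (λ vz<vx → <-trans vz<vx vx<vy))
    x (subst₂ ℕ._<_ (sym (indicator-no (v x <? v x) <-irrefl))
                    (sym (indicator-yes (v x <? v y) vx<vy)) (s≤s z≤n))

  rankℕ<n : ∀ x → rankℕ x ℕ.< n
  rankℕ<n x = subst₂ ℕ._<_ refl sum-ones
    (sum-mono-< (λ y → indicator≤1 (isYes (v y <? v x))) x
                (subst₂ ℕ._<_ (sym (indicator-no (v x <? v x) <-irrefl)) refl (s≤s z≤n)))

  rankℕ-injective : Injective _≡_ _≡_ rankℕ
  rankℕ-injective {x} {y} rx≡ry with compare (v x) (v y)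
  ... | tri< vx<vy _ _ = contradiction rx≡ry (ℕP.<⇒≢ (rankℕ-mono vx<vy))
  ... | tri≈ _ vx≈vy _ = v-injective vx≈vy
  ... | tri> _ _ vy<vx = contradiction (sym rx≡ry) (ℕP.<⇒≢ (rankℕ-mono vy<vx))

  rank : Permutation′ n
  rank = injective⇒permutation (λ x → fromℕ< (rankℕ<n x)) λ eq →
    rankℕ-injective (trans (sym (toℕ-fromℕ< _)) (trans (cong toℕ eq) (toℕ-fromℕ< _)))

  toℕ-rank : ∀ x → toℕ (rank ⟨$⟩ʳ x) ≡ rankℕ x
  toℕ-rank x = toℕ-fromℕ< (rankℕ<n x)

  rank-<⇔ : ∀ {x y} → v x < v y ⇔ toℕ (rank ⟨$⟩ʳ x) ℕ.< toℕ (rank ⟨$⟩ʳ y)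
  rank-<⇔ {x} {y} = mk⇔
    (λ vx<vy → subst₂ ℕ._<_ (sym (toℕ-rank x)) (sym (toℕ-rank y)) (rankℕ-mono vx<vy))
    (λ rx<ry → rankℕ-reflects-< (subst₂ ℕ._<_ (toℕ-rank x) (toℕ-rank y) rx<ry))
    where
    rankℕ-reflects-< : rankℕ x ℕ.< rankℕ y → v x < v y
    rankℕ-reflects-< rx<ry with compare (v x) (v y)
    ... | tri< vx<vy _ _ = vx<vy
    ... | tri≈ _ vx≈vy _ = contradiction (cong rankℕ (v-injective vx≈vy)) (ℕP.<⇒≢ rx<ry)
    ... | tri> _ _ vy<vx = contradiction rx<ry (ℕP.<⇒≯ (rankℕ-mono vy<vx))

sign : Bool → Sign
sign true  = neg
sign false = pos

isNeg : Sign → Bool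
isNeg pos = false
isNeg neg = true

isNeg-sign : ∀ b → isNeg (sign b) ≡ b
isNeg-sign true  = refl
isNeg-sign false = refl

sign-isNeg : ∀ s → sign (isNeg s) ≡ s
sign-isNeg pos = refl
sign-isNeg neg = refl

infixl 7 _·_
infixr 6 _⊙_

_·_ : Sign → Sign → Sign
pos · t   = t
neg · pos = neg
neg · neg = pos

·-identityʳ : ∀ s → s · pos ≡ s
·-identityʳ pos = refl
·-identityʳ neg = refl

·-assoc : ∀ s t u → s · t · u ≡ s · (t · u)
·-assoc pos t   u   = refl
·-assoc neg pos u   = refl
·-assoc neg neg pos = refl
·-assoc neg neg neg = refl

·-cancelʳ : ∀ s t → s · t · t ≡ s
·-cancelʳ s   pos = trans (·-identityʳ (s · pos)) (·-identityʳ s)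
·-cancelʳ pos neg = refl
·-cancelʳ neg neg = refl

_⊙_ : Sign → PM d → PM d
s ⊙ (t , a) = (s · t , a)

negate≡neg⊙ : (x : PM d) → negate x ≡ neg ⊙ x
negate≡neg⊙ (pos , a) = refl
negate≡neg⊙ (neg , a) = refl

Odd : (PM d → PM d) → Set
Odd f = ∀ x → f (negate x) ≡ negate (f x)

module _ {f : PM d → PM d} (f-odd : Odd f) where

  odd⇒⊙-equivariant : ∀ s x → f (s ⊙ x) ≡ s ⊙ f x
  odd⇒⊙-equivariant pos (t , a) = refl
  odd⇒⊙-equivariant neg x = begin
    f (neg ⊙ x)    ≡⟨ cong f (negate≡neg⊙ x) ⟨
    f (negate x)   ≡⟨ f-odd x ⟩
    negate (f x)   ≡⟨ negate≡neg⊙ (f x) ⟩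
    neg ⊙ f x      ∎
    where open ≡-Reasoning

  odd⇒proj₂-sign-invariant : ∀ x → proj₂ (f (pos , proj₂ x)) ≡ proj₂ (f x)
  odd⇒proj₂-sign-invariant (s , a) = begin
    proj₂ (f (pos , a))       ≡⟨⟩
    proj₂ (s ⊙ f (pos , a))   ≡⟨ cong proj₂ (odd⇒⊙-equivariant s (pos , a)) ⟨
    proj₂ (f (s · pos , a))   ≡⟨ cong (λ t → proj₂ (f (t , a))) (·-identityʳ s) ⟩
    proj₂ (f (s , a))         ∎
    where open ≡-Reasoning

-- Signed permutations as a subset of [d] and a permutation of [d]

⟦_⟧ : SignedPerm d → PM d → PM d
⟦ τ ⟧ = Inverse.to (proj₁ τ)

⟦_⟧⁻¹ : SignedPerm d → PM d → PM d
⟦ τ ⟧⁻¹ = Inverse.from (proj₁ τ)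

infix 4 _≈±_

_≈±_ : SignedPerm d → SignedPerm d → Set
τ ≈± τ′ = ∀ x → ⟦ τ ⟧ x ≡ ⟦ τ′ ⟧ x

signedPerm : Subset d → Permutation′ d → SignedPerm d
signedPerm {d} S ρ = mk↔ₛ′ to from to∘from from∘to , to-odd
  where
  ε : Fin d → Sign
  ε b = sign (lookup S b)

  to : PM d → PM d
  to (s , a) = (s · ε (ρ ⟨$⟩ʳ a) , ρ ⟨$⟩ʳ a)

  from : PM d → PM d
  from (s , b) = (s · ε b , ρ ⟨$⟩ˡ b)

  to∘from : ∀ y → to (from y) ≡ y
  to∘from (s , b) rewrite inverseʳ ρ {b} = cong (_, b) (·-cancelʳ s (ε b))

  from∘to : ∀ x → from (to x) ≡ x
  from∘to (s , a) = cong₂ _,_ (·-cancelʳ s (ε (ρ ⟨$⟩ʳ a))) (inverseˡ ρ)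

  to-odd : Odd to
  to-odd x = begin
    to (negate x)   ≡⟨ cong to (negate≡neg⊙ x) ⟩
    to (neg ⊙ x)    ≡⟨ cong (_, _) (·-assoc neg (proj₁ x) _) ⟩
    neg ⊙ to x      ≡⟨ negate≡neg⊙ (to x) ⟨
    negate (to x)   ∎
    where open ≡-Reasoning

signedPerm-cong : (S : Subset d) (ρ ρ′ : Permutation′ d) →
                  ρ Perm.≈ ρ′ → signedPerm S ρ ≈± signedPerm S ρ′
signedPerm-cong S ρ ρ′ ρ≈ρ′ (s , a) = cong (λ b → (s · sign (lookup S b) , b)) (ρ≈ρ′ a)

module _ (τ : SignedPerm d) where

  private
    τ-odd : Odd ⟦ τ ⟧
    τ-odd = proj₂ τ

    τ⁻¹-odd : Odd ⟦ τ ⟧⁻¹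
    τ⁻¹-odd y = begin
      ⟦ τ ⟧⁻¹ (negate y)
        ≡⟨ cong (⟦ τ ⟧⁻¹ ∘ negate) (Inverse.strictlyInverseˡ (proj₁ τ) y) ⟨
      ⟦ τ ⟧⁻¹ (negate (⟦ τ ⟧ (⟦ τ ⟧⁻¹ y)))
        ≡⟨ cong ⟦ τ ⟧⁻¹ (τ-odd (⟦ τ ⟧⁻¹ y)) ⟨
      ⟦ τ ⟧⁻¹ (⟦ τ ⟧ (negate (⟦ τ ⟧⁻¹ y)))
        ≡⟨ Inverse.strictlyInverseʳ (proj₁ τ) _ ⟩
      negate (⟦ τ ⟧⁻¹ y) ∎
      where open ≡-Reasoning

  unsign : Permutation′ d
  unsign = permutation (λ a → proj₂ (⟦ τ ⟧ (pos , a))) (λ b → proj₂ (⟦ τ ⟧⁻¹ (pos , b)))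
    (λ b → trans (odd⇒proj₂-sign-invariant τ-odd _)
                 (cong proj₂ (Inverse.strictlyInverseˡ (proj₁ τ) (pos , b))))
    (λ a → trans (odd⇒proj₂-sign-invariant τ⁻¹-odd _)
                 (cong proj₂ (Inverse.strictlyInverseʳ (proj₁ τ) (pos , a))))

  negativeValues : Subset d
  negativeValues = tabulate (λ b → isNeg (proj₁ (⟦ τ ⟧ (pos , unsign ⟨$⟩ˡ b))))

  signedPerm-decompose : τ ≈± signedPerm negativeValues unsign
  signedPerm-decompose (s , a) = begin
    ⟦ τ ⟧ (s , a)
      ≡⟨ cong (λ t → ⟦ τ ⟧ (t , a)) (·-identityʳ s) ⟨
    ⟦ τ ⟧ (s ⊙ (pos , a))
      ≡⟨ odd⇒⊙-equivariant τ-odd s (pos , a) ⟩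
    (s · proj₁ (⟦ τ ⟧ (pos , a)) , unsign ⟨$⟩ʳ a)
      ≡⟨ cong (λ t → (s · t , unsign ⟨$⟩ʳ a)) sign-of-image ⟨
    ⟦ signedPerm negativeValues unsign ⟧ (s , a) ∎
    where
    open ≡-Reasoning
    sign-of-image : sign (lookup negativeValues (unsign ⟨$⟩ʳ a)) ≡ proj₁ (⟦ τ ⟧ (pos , a))
    sign-of-image = begin
      sign (lookup negativeValues (unsign ⟨$⟩ʳ a))
        ≡⟨ cong sign (lookup∘tabulate (λ b → isNeg (proj₁ (⟦ τ ⟧ (pos , unsign ⟨$⟩ˡ b)))) _) ⟩
      sign (isNeg (proj₁ (⟦ τ ⟧ (pos , unsign ⟨$⟩ˡ (unsign ⟨$⟩ʳ a)))))
        ≡⟨ sign-isNeg _ ⟩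
      proj₁ (⟦ τ ⟧ (pos , unsign ⟨$⟩ˡ (unsign ⟨$⟩ʳ a)))
        ≡⟨ cong (λ a′ → proj₁ (⟦ τ ⟧ (pos , a′))) (inverseˡ unsign) ⟩
      proj₁ (⟦ τ ⟧ (pos , a)) ∎

negativeValues-signedPerm : (S : Subset d) (ρ : Permutation′ d) →
                            negativeValues (signedPerm S ρ) ≡ S
negativeValues-signedPerm S ρ = begin
  tabulate (λ b → isNeg (sign (lookup S (ρ ⟨$⟩ʳ (ρ ⟨$⟩ˡ b)))))
    ≡⟨ tabulate-cong (λ b → isNeg-sign _) ⟩
  tabulate (λ b → lookup S (ρ ⟨$⟩ʳ (ρ ⟨$⟩ˡ b)))
    ≡⟨ tabulate-cong (λ b → cong (lookup S) (inverseʳ ρ)) ⟩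
  tabulate (lookup S)
    ≡⟨ tabulate∘lookup S ⟩
  S ∎
  where open ≡-Reasoning

negativeValues-cong : (τ τ′ : SignedPerm d) → τ ≈± τ′ → negativeValues τ ≡ negativeValues τ′
negativeValues-cong τ τ′ τ≈τ′ = tabulate-cong λ b →
  cong (isNeg ∘ proj₁) (trans (cong (λ a → ⟦ τ ⟧ (pos , a)) (unsign⁻¹-cong b)) (τ≈τ′ _))
  where
  open ≡-Reasoning
  unsign⁻¹-cong : ∀ b → unsign τ ⟨$⟩ˡ b ≡ unsign τ′ ⟨$⟩ˡ b
  unsign⁻¹-cong b = begin
    unsign τ ⟨$⟩ˡ b
      ≡⟨ inverseˡ (unsign τ′) ⟨
    unsign τ′ ⟨$⟩ˡ (unsign τ′ ⟨$⟩ʳ (unsign τ ⟨$⟩ˡ b))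
      ≡⟨ cong (λ x → unsign τ′ ⟨$⟩ˡ proj₂ x) (τ≈τ′ _) ⟨
    unsign τ′ ⟨$⟩ˡ (unsign τ ⟨$⟩ʳ (unsign τ ⟨$⟩ˡ b))
      ≡⟨ cong (unsign τ′ ⟨$⟩ˡ_) (inverseʳ (unsign τ)) ⟩
    unsign τ′ ⟨$⟩ˡ b ∎

value-injective : Injective _≡_ _≡_ (value {d})
value-injective {x = pos , a} {y = pos , b} eq =
  cong (pos ,_) (toℕ-injective (ℕP.suc-injective (ℤP.+-injective eq)))
value-injective {x = neg , a} {y = neg , b} eq =
  cong (neg ,_) (toℕ-injective (ℤP.-[1+-injective eq))
value-injective {x = pos , a} {y = neg , b} ()
value-injective {x = neg , a} {y = pos , b} ()

value≢+0 : (x : PM d) → value x ≢ + 0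
value≢+0 (pos , a) ()
value≢+0 (neg , a) ()

value-negative : (x : PM d) (x<0? : Dec (value x ℤ.< + 0)) → isYes x<0? ≡ isNeg (proj₁ x)
value-negative (pos , a) (no _)           = refl
value-negative (pos , a) (yes (ℤ.+<+ ()))
value-negative (neg , a) (yes _)          = refl
value-negative (neg , a) (no ¬x<0)        = contradiction ℤ.-<+ ¬x<0

value-sign-negative : ∀ b (a : Fin d) (x<0? : Dec (value (sign b , a) ℤ.< + 0)) →
                      indicator (isYes x<0?) ≡ indicator b
value-sign-negative b a x<0? = cong indicator (trans (value-negative (sign b , a) x<0?) (isNeg-sign b))

applyB-suc : (τ : SignedPerm d) (a : Fin d) → applyB τ (suc (toℕ a)) ≡ value (⟦ τ ⟧ (pos , a))
applyB-suc {d} τ a with toℕ a ℕ.<? d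
... | yes a<d = cong (λ a′ → value (⟦ τ ⟧ (pos , a′))) (fromℕ<-toℕ a a<d)
... | no  a≮d = contradiction (toℕ<n a) a≮d

applyB-cong : {τ τ′ : SignedPerm d} → τ ≈± τ′ → ∀ k → applyB τ k ≡ applyB τ′ k
applyB-cong τ≈τ′ zero = refl
applyB-cong {d} τ≈τ′ (suc k) with k ℕ.<? d
... | yes k<d = cong value (τ≈τ′ (pos , fromℕ< k<d))
... | no  _   = refl

desB-cong : {τ τ′ : SignedPerm d} → τ ≈± τ′ → desB τ ≡ desB τ′
desB-cong {d} τ≈τ′ = count-cong d λ k →
  cong₂ (λ u w → isYes (u ℤ.<? w)) (applyB-cong τ≈τ′ (suc (toℕ k))) (applyB-cong τ≈τ′ (toℕ k))

negs-cong : {τ τ′ : SignedPerm d} → τ ≈± τ′ → negs τ ≡ negs τ′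
negs-cong {d} τ≈τ′ = count-cong d λ k →
  cong (λ u → isYes (u ℤ.<? + 0)) (applyB-cong τ≈τ′ (suc (toℕ k)))

negs-signedPerm : (S : Subset d) (ρ : Permutation′ d) → negs (signedPerm S ρ) ≡ ∣ S ∣
negs-signedPerm {d} S ρ = begin
  negs (signedPerm S ρ)
    ≡⟨ count≡sum d _ ⟩
  sum (λ (a : Fin d) → indicator (isYes (applyB τ (suc (toℕ a)) ℤ.<? + 0)))
    ≡⟨ sum-cong-≗ {d} (λ a → trans (cong (λ u → indicator (isYes (u ℤ.<? + 0))) (applyB-suc τ a))
                                    (value-sign-negative (lookup S (ρ ⟨$⟩ʳ a)) _ _)) ⟩
  sum (λ a → indicator (lookup S (ρ ⟨$⟩ʳ a)))
    ≡⟨ sum-permute {d} {d} (indicator ∘ lookup S) ρ ⟨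
  sum (indicator ∘ lookup S)
    ≡⟨ ∣p∣≡sum-lookup S ⟨
  ∣ S ∣ ∎
  where
  open ≡-Reasoning
  τ = signedPerm S ρ

-- Ranking the values 0, ±1, …, ±d

signedValue : Subset d → Fin (suc d) → ℤ
signedValue S F.zero    = + 0
signedValue S (F.suc b) = value (sign (lookup S b) , b)

signedValue-injective : (S : Subset d) → Injective _≡_ _≡_ (signedValue S)
signedValue-injective S {F.zero}  {F.zero}  _  = refl
signedValue-injective S {F.zero}  {F.suc b} eq = contradiction (sym eq) (value≢+0 (sign (lookup S b) , b))
signedValue-injective S {F.suc a} {F.zero}  eq = contradiction eq (value≢+0 (sign (lookup S a) , a))
signedValue-injective S {F.suc a} {F.suc b} eq =
  cong (F.suc ∘ proj₂) (value-injective {x = sign (lookup S a) , a} {y = sign (lookup S b) , b} eq)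

applyB-signedPerm : (S : Subset d) (ρ : Permutation′ d) (x : Fin (suc d)) →
                    applyB (signedPerm S ρ) (toℕ x) ≡ signedValue S (lift₀ ρ ⟨$⟩ʳ x)
applyB-signedPerm S ρ F.zero    = refl
applyB-signedPerm S ρ (F.suc a) = applyB-suc (signedPerm S ρ) a

apply-toℕ : (σ : Permutation′ n) (x : Fin n) → apply σ (toℕ x) ≡ toℕ (σ ⟨$⟩ʳ x)
apply-toℕ {n} σ x with toℕ x ℕ.<? n
... | yes x<n = cong (λ y → toℕ (σ ⟨$⟩ʳ y)) (fromℕ<-toℕ x x<n)
... | no  x≮n = contradiction (toℕ<n x) x≮n

module _ (S : Subset d) where

  private
    module R = Ranking ℤP.<-strictTotalOrder (signedValue S) (signedValue-injective S)

  signedRank : Permutation′ (suc d)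
  signedRank = R.rank

  toℕ-signedRank-zero : toℕ (signedRank ⟨$⟩ʳ F.zero) ≡ ∣ S ∣
  toℕ-signedRank-zero = begin
    toℕ (signedRank ⟨$⟩ʳ F.zero)
      ≡⟨ R.toℕ-rank F.zero ⟩
    indicator (isYes (+ 0 <? + 0)) + sum (λ b → indicator (isYes (signedValue S (F.suc b) <? + 0)))
      ≡⟨ cong₂ _+_ (indicator-no (+ 0 <? + 0) (ℤP.<-irrefl refl))
                   (sum-cong-≗ {d} (λ b → value-sign-negative (lookup S b) b _)) ⟩
    sum (indicator ∘ lookup S)
      ≡⟨ ∣p∣≡sum-lookup S ⟨
    ∣ S ∣ ∎
    where
    open ≡-Reasoning
    open StrictTotalOrder ℤP.<-strictTotalOrder using (_<?_)

  unrank : Permutation′ (suc d) → Permutation′ d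
  unrank σ = remove F.zero (σ ∘ₚ flip signedRank)

  signedRank-lift₀-unrank : (σ : Permutation′ (suc d)) → σ ⟨$⟩ʳ F.zero ≡ signedRank ⟨$⟩ʳ F.zero →
                            ∀ x → σ ⟨$⟩ʳ x ≡ signedRank ⟨$⟩ʳ (lift₀ (unrank σ) ⟨$⟩ʳ x)
  signedRank-lift₀-unrank σ σ0≡rank0 x = begin
    σ ⟨$⟩ʳ x
      ≡⟨ inverseʳ signedRank ⟨
    signedRank ⟨$⟩ʳ (signedRank ⟨$⟩ˡ (σ ⟨$⟩ʳ x))
      ≡⟨ cong (signedRank ⟨$⟩ʳ_) (lift₀-remove (σ ∘ₚ flip signedRank) fixes-zero x) ⟨
    signedRank ⟨$⟩ʳ (lift₀ (unrank σ) ⟨$⟩ʳ x) ∎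
    where
    open ≡-Reasoning
    fixes-zero : signedRank ⟨$⟩ˡ (σ ⟨$⟩ʳ F.zero) ≡ F.zero
    fixes-zero = trans (cong (signedRank ⟨$⟩ˡ_) σ0≡rank0) (inverseˡ signedRank)

  unrank-unique : (ρ : Permutation′ d) (σ : Permutation′ (suc d)) →
                  (∀ x → σ ⟨$⟩ʳ x ≡ signedRank ⟨$⟩ʳ (lift₀ ρ ⟨$⟩ʳ x)) → unrank σ Perm.≈ ρ
  unrank-unique ρ σ σ≡rank∘ρ a = suc-injective (begin
    lift₀ (unrank σ) ⟨$⟩ʳ F.suc a
      ≡⟨ inverseˡ signedRank ⟨
    signedRank ⟨$⟩ˡ (signedRank ⟨$⟩ʳ (lift₀ (unrank σ) ⟨$⟩ʳ F.suc a))
      ≡⟨ cong (signedRank ⟨$⟩ˡ_) (signedRank-lift₀-unrank σ (σ≡rank∘ρ F.zero) (F.suc a)) ⟨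
    signedRank ⟨$⟩ˡ (σ ⟨$⟩ʳ F.suc a)
      ≡⟨ cong (signedRank ⟨$⟩ˡ_) (σ≡rank∘ρ (F.suc a)) ⟩
    signedRank ⟨$⟩ˡ (signedRank ⟨$⟩ʳ (lift₀ ρ ⟨$⟩ʳ F.suc a))
      ≡⟨ inverseˡ signedRank ⟩
    lift₀ ρ ⟨$⟩ʳ F.suc a ∎)
    where open ≡-Reasoning

  desB-signedPerm : (ρ : Permutation′ d) (σ : Permutation′ (suc d)) →
                    (∀ x → σ ⟨$⟩ʳ x ≡ signedRank ⟨$⟩ʳ (lift₀ ρ ⟨$⟩ʳ x)) →
                    desB (signedPerm S ρ) ≡ des σ
  desB-signedPerm ρ σ σ≡rank∘ρ = count-cong d descent-at
    where
    open ≡-Reasoning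
    τ = signedPerm S ρ

    w : Fin (suc d) → Fin (suc d)
    w x = lift₀ ρ ⟨$⟩ʳ x

    rank-at : ∀ x → apply σ (toℕ x) ≡ toℕ (signedRank ⟨$⟩ʳ w x)
    rank-at x = trans (apply-toℕ σ x) (cong toℕ (σ≡rank∘ρ x))

    value-before : ∀ a → applyB τ (toℕ a) ≡ signedValue S (w (inject₁ a))
    value-before a = trans (cong (applyB τ) (sym (toℕ-inject₁ a))) (applyB-signedPerm S ρ (inject₁ a))

    rank-before : ∀ a → apply σ (toℕ a) ≡ toℕ (signedRank ⟨$⟩ʳ w (inject₁ a))
    rank-before a = trans (cong (apply σ) (sym (toℕ-inject₁ a))) (rank-at (inject₁ a))

    descent-at : ∀ a → isYes (applyB τ (suc (toℕ a)) ℤ.<? applyB τ (toℕ a))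
                     ≡ isYes (apply σ (suc (toℕ a)) ℕ.<? apply σ (toℕ a))
    descent-at a = begin
      isYes (applyB τ (toℕ (F.suc a)) ℤ.<? applyB τ (toℕ a))
        ≡⟨ cong₂ (λ u v → isYes (u ℤ.<? v)) (applyB-signedPerm S ρ (F.suc a)) (value-before a) ⟩
      isYes (signedValue S (w (F.suc a)) ℤ.<? signedValue S (w (inject₁ a)))
        ≡⟨ isYes-⇔ (R.rank-<⇔ {w (F.suc a)} {w (inject₁ a)}) _ _ ⟩
      isYes (toℕ (signedRank ⟨$⟩ʳ w (F.suc a)) ℕ.<? toℕ (signedRank ⟨$⟩ʳ w (inject₁ a)))
        ≡⟨ cong₂ (λ u v → isYes (u ℕ.<? v)) (rank-at (F.suc a)) (rank-before a) ⟨
      isYes (apply σ (toℕ (F.suc a)) ℕ.<? apply σ (toℕ a)) ∎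

-- Opaque, so that conversion checking compares the arguments of rankedPerm instead of
-- unfolding the ranking permutation.
opaque
  rankedPerm : SignedPerm d → Permutation′ (suc d)
  rankedPerm τ = lift₀ (unsign τ) ∘ₚ signedRank (negativeValues τ)

  rankedPerm-apply : (τ : SignedPerm d) → ∀ x →
    rankedPerm τ ⟨$⟩ʳ x ≡ signedRank (negativeValues τ) ⟨$⟩ʳ (lift₀ (unsign τ) ⟨$⟩ʳ x)
  rankedPerm-apply τ x = refl

toℕ-rankedPerm-zero : (τ : SignedPerm d) → toℕ (rankedPerm τ ⟨$⟩ʳ F.zero) ≡ ∣ negativeValues τ ∣
toℕ-rankedPerm-zero τ =
  trans (cong toℕ (rankedPerm-apply τ F.zero)) (toℕ-signedRank-zero (negativeValues τ))

rankedPerm-signedPerm : (S : Subset d) (ρ : Permutation′ d) → ∀ x →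
                        rankedPerm (signedPerm S ρ) ⟨$⟩ʳ x ≡ signedRank S ⟨$⟩ʳ (lift₀ ρ ⟨$⟩ʳ x)
rankedPerm-signedPerm S ρ x = trans (rankedPerm-apply (signedPerm S ρ) x)
  (cong₂ (λ S′ y → signedRank S′ ⟨$⟩ʳ y) (negativeValues-signedPerm S ρ) (lift₀-cong _ ρ (λ _ → refl) x))

rankedPerm-cong : (τ τ′ : SignedPerm d) → τ ≈± τ′ → rankedPerm τ Perm.≈ rankedPerm τ′
rankedPerm-cong τ τ′ τ≈τ′ x = begin
  rankedPerm τ ⟨$⟩ʳ x
    ≡⟨ rankedPerm-apply τ x ⟩
  signedRank (negativeValues τ) ⟨$⟩ʳ (lift₀ (unsign τ) ⟨$⟩ʳ x)
    ≡⟨ cong₂ (λ S y → signedRank S ⟨$⟩ʳ y) (negativeValues-cong τ τ′ τ≈τ′)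
             (lift₀-cong (unsign τ) (unsign τ′) (λ a → cong proj₂ (τ≈τ′ (pos , a))) x) ⟩
  signedRank (negativeValues τ′) ⟨$⟩ʳ (lift₀ (unsign τ′) ⟨$⟩ʳ x)
    ≡⟨ rankedPerm-apply τ′ x ⟨
  rankedPerm τ′ ⟨$⟩ʳ x ∎
  where open ≡-Reasoning

unrank-rankedPerm : (τ : SignedPerm d) → unrank (negativeValues τ) (rankedPerm τ) Perm.≈ unsign τ
unrank-rankedPerm τ = unrank-unique (negativeValues τ) (unsign τ) (rankedPerm τ) (rankedPerm-apply τ)

∣negativeValues∣≡negs : (τ : SignedPerm d) → ∣ negativeValues τ ∣ ≡ negs τ
∣negativeValues∣≡negs τ = trans (sym (negs-signedPerm (negativeValues τ) (unsign τ)))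
                               (negs-cong (sym ∘ signedPerm-decompose τ))

des-rankedPerm : (τ : SignedPerm d) → des (rankedPerm τ) ≡ desB τ
des-rankedPerm τ =
  trans (sym (desB-signedPerm (negativeValues τ) (unsign τ) (rankedPerm τ) (rankedPerm-apply τ)))
        (desB-cong (sym ∘ signedPerm-decompose τ))

module _ (d i j : ℕ) where

  private
    module P = Setoid (PairSetoid d i (suc j))
    module B = Setoid (SignedSetoid d i (suc j))

    σ-zero≡signedRank-zero : (S : Subset d) (σ : Permutation′ (suc d)) → ∣ S ∣ ≡ j →
                             suc (toℕ (σ ⟨$⟩ʳ F.zero)) ≡ suc j →
                             σ ⟨$⟩ʳ F.zero ≡ signedRank S ⟨$⟩ʳ F.zero
    σ-zero≡signedRank-zero S σ ∣S∣≡j σ0≡j = toℕ-injective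
      (trans (ℕP.suc-injective σ0≡j) (trans (sym ∣S∣≡j) (sym (toℕ-signedRank-zero S))))

  toSigned : P.Carrier → B.Carrier
  toSigned ((S , σ) , ∣S∣≡j , desσ≡i , σ0≡j) =
    signedPerm S (unrank S σ) ,
    trans (desB-signedPerm S (unrank S σ) σ
            (signedRank-lift₀-unrank S σ (σ-zero≡signedRank-zero S σ ∣S∣≡j σ0≡j)))
          desσ≡i ,
    trans (negs-signedPerm S (unrank S σ)) ∣S∣≡j

  fromSigned : B.Carrier → P.Carrier
  fromSigned (τ , desBτ≡i , negsτ≡j) =
    (negativeValues τ , rankedPerm τ) ,
    ∣S∣≡j , trans (des-rankedPerm τ) desBτ≡i , cong suc (trans (toℕ-rankedPerm-zero τ) ∣S∣≡j)
    where
    ∣S∣≡j : ∣ negativeValues τ ∣ ≡ j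
    ∣S∣≡j = trans (∣negativeValues∣≡negs τ) negsτ≡j

  toSigned-cong : Congruent P._≈_ B._≈_ toSigned
  toSigned-cong {(S , σ) , _} {(_ , σ′) , ∣S∣≡j , _ , σ′0≡j} (refl , σ≈σ′) =
    signedPerm-cong S (unrank S σ) (unrank S σ′) (unrank-unique S (unrank S σ′) σ λ x →
      trans (σ≈σ′ x) (signedRank-lift₀-unrank S σ′ (σ-zero≡signedRank-zero S σ′ ∣S∣≡j σ′0≡j) x))

  fromSigned-cong : Congruent B._≈_ P._≈_ fromSigned
  fromSigned-cong {τ , _} {τ′ , _} τ≈τ′ = negativeValues-cong τ τ′ τ≈τ′ , rankedPerm-cong τ τ′ τ≈τ′

  toSigned-fromSigned : StrictlyInverseˡ B._≈_ toSigned fromSigned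
  toSigned-fromSigned (τ , _) x = trans
    (signedPerm-cong (negativeValues τ) (unrank (negativeValues τ) (rankedPerm τ)) (unsign τ)
                     (unrank-rankedPerm τ) x)
    (sym (signedPerm-decompose τ x))

  fromSigned-toSigned : StrictlyInverseʳ P._≈_ toSigned fromSigned
  fromSigned-toSigned ((S , σ) , ∣S∣≡j , _ , σ0≡j) = negativeValues-signedPerm S (unrank S σ) , λ x →
    trans (rankedPerm-signedPerm S (unrank S σ) x)
          (sym (signedRank-lift₀-unrank S σ (σ-zero≡signedRank-zero S σ ∣S∣≡j σ0≡j) x))

  pairs↔signedPerms : Inverse (PairSetoid d i (suc j)) (SignedSetoid d i (suc j))
  pairs↔signedPerms = record
    { to        = toSigned
    ; from      = fromSigned
    ; to-cong   = λ {p} {p′} → toSigned-cong {p} {p′}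
    ; from-cong = λ {t} {t′} → fromSigned-cong {t} {t′}
    ; inverse   = (λ {t} {p} p≈ → B.trans {toSigned p} {toSigned (fromSigned t)} {t}
                                    (toSigned-cong {p} {fromSigned t} p≈) (toSigned-fromSigned t))
                , (λ {p} {t} t≈ → P.trans {fromSigned t} {fromSigned (toSigned p)} {p}
                                    (fromSigned-cong {t} {toSigned p} t≈) (fromSigned-toSigned p))
    }

lemma3p2 : (d i j : ℕ) → 1 ≤ d → 1 ≤ j → j ≤ suc d → i ≤ d
           → Bijection (PairSetoid d i j) (SignedSetoid d i j)
lemma3p2 d i zero    _ ()
lemma3p2 d i (suc j) _ _  _ _ = Inverse⇒Bijection (pairs↔signedPerms d i j)
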